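{- Let $G$ be the grid defined in the context. For every $i,j\ge0$ and every string $Y$ over the digits $\{0,1\}$ that is either empty or begins with the digit $1$, the concatenation $\overline{Y\,G(i,j)}$ (the string $Y$ followed by the string $G(i,j)$) equals $G(i,j')$ for some $j'\ge0$; i.e., it lies in the same row $i$.
   Context: For a finite string $w=a_na_{n-1}\cdots a_0$ over digits $\{0,1,2\}$ let $[w]_{3/2}=\sum_k a_k(3/2)^k$ and $[w]_3=\sum_k a_k3^k$. Define an operation $T$ on such strings ("adding 2 in base $\frac32$"): if $w$ contains no digit $0$, first replace $w$ by $0w$; then change the rightmost $0$ of $w$ into $2$, change every digit to the right of it by $1\mapsto0$, $2\mapsto1$, and leave all digits to the left of it unchanged. Then $[T(w)]_{3/2}=[w]_{3/2}+2$. The grid $G$ has entries $G(i,j)$ for $i,j\ge0$: $G(0,j)$ is the binary representation of $j$ (so row $0$ is $0,1,10,11,100,\dots$), and $G(i+1,j)=T(G(i,j))$. The set $\{G(i,j):j\ge0\}$ is called row $i$. (Every string over $\{0,1,2\}$ not starting with $0$, together with the string $0$, appears exactly once in $G$.) -}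

module Defs where

open import Data.Nat using (ℕ; zero; suc)
open import Data.Fin using (Fin; zero; suc)
open import Data.List using (List; []; _∷_; reverse; _++_)

Digit : Set
Digit = Fin 3

d0 d1 d2 : Digit
d0 = zero
d1 = suc zero
d2 = suc (suc zero)

-- A string w = a_n a_{n-1} ... a_0 is a list written most-significant digit first,
-- i.e. the list [a_n , ... , a_0].
Str : Set
Str = List Digit

-- T acting on the reversed string (least significant digit first):
-- the rightmost 0 becomes 2, digits to its right map 1↦0, 2↦1;
-- if there is no 0, a leading 0 is prepended first (which then becomes 2).
Tʳ : Str → Str
Tʳ []                      = d2 ∷ []
Tʳ (zero ∷ ds)             = d2 ∷ ds
Tʳ (suc zero ∷ ds)         = d0 ∷ Tʳ ds
Tʳ (suc (suc zero) ∷ ds)   = d1 ∷ Tʳ ds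

-- The operation T ("adding 2 in base 3/2") on strings written MSB first.
T : Str → Str
T w = reverse (Tʳ (reverse w))

incʳ : Str → Str
incʳ []                 = d1 ∷ []
incʳ (zero ∷ ds)        = d1 ∷ ds
incʳ (suc _ ∷ ds)       = d0 ∷ incʳ ds

-- Binary representation of j, LSB first, without leading zeros (empty for 0).
binʳ : ℕ → Str
binʳ zero    = []
binʳ (suc j) = incʳ (binʳ j)

-- Binary representation of j, MSB first; 0 is represented by the string "0".
bin : ℕ → Str
bin zero        = d0 ∷ []
bin j@(suc _)   = reverse (binʳ j)

iterT : ℕ → Str → Str
iterT zero    w = w
iterT (suc i) w = T (iterT i w)

G : ℕ → ℕ → Str
G i j = iterT i (bin j)

data Binary : Str → Set where
  []  : Binary []
  _∷0 : ∀ {ds} → Binary ds → Binary (d0 ∷ ds)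
  _∷1 : ∀ {ds} → Binary ds → Binary (d1 ∷ ds)

data EmptyOrStarts1 : Str → Set where
  empty  : EmptyOrStarts1 []
  starts : ∀ {ds} → EmptyOrStarts1 (d1 ∷ ds)

-- T only changes the digits up to (and including) the rightmost 0 of
-- its argument; digits further left are untouched.  Hence for every word u
-- there is a "pad" z, namely z = ε if u contains a 0 and z = 0 otherwise
-- (then the inserted 0 plays the role of the leading 0 that T would
-- prepend), such that   T (Y ++ z ++ u) = Y ++ T u   for every prefix Y.

module Submission where

open import Defs
open import Data.Nat using (ℕ; zero; suc; _+_)
open import Data.Fin using (zero; suc)
open import Data.Nat.Properties using (+-suc)
open import Data.List using ([]; _∷_; _++_; reverse; [_])
open import Data.List.Properties
  using (reverse-++; reverse-involutive; unfold-reverse; ++-assoc)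
open import Data.Product using (∃; _,_; _×_)
open import Relation.Binary.PropositionalEquality
  using (_≡_; refl; sym; trans; cong; module ≡-Reasoning)

binary-++ : ∀ {xs ys} → Binary xs → Binary ys → Binary (xs ++ ys)
binary-++ []       ys = ys
binary-++ (xs ∷0) ys = binary-++ xs ys ∷0
binary-++ (xs ∷1) ys = binary-++ xs ys ∷1

binary-reverse : ∀ {xs} → Binary xs → Binary (reverse xs)
binary-reverse [] = []
binary-reverse {d ∷ xs} (b ∷0) rewrite unfold-reverse d xs =
  binary-++ (binary-reverse b) ([] ∷0)
binary-reverse {d ∷ xs} (b ∷1) rewrite unfold-reverse d xs =
  binary-++ (binary-reverse b) ([] ∷1)

binary-incʳ : ∀ {xs} → Binary xs → Binary (incʳ xs)
binary-incʳ []       = [] ∷1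
binary-incʳ (b ∷0) = b ∷1
binary-incʳ (b ∷1) = binary-incʳ b ∷0

binary-bin : ∀ j → Binary (bin j)
binary-bin zero    = [] ∷0
binary-bin (suc j) = binary-reverse (binary-binʳ (suc j))
  where
  binary-binʳ : ∀ k → Binary (binʳ k)
  binary-binʳ zero    = []
  binary-binʳ (suc k) = binary-incʳ (binary-binʳ k)

binʳ-odd : ∀ k → binʳ (suc (k + k)) ≡ d1 ∷ binʳ k
binʳ-odd zero = refl
binʳ-odd (suc k) rewrite +-suc k k | binʳ-odd k = refl

binʳ-even : ∀ k → binʳ (suc k + suc k) ≡ d0 ∷ binʳ (suc k)
binʳ-even k rewrite +-suc k k | binʳ-odd k = refl

binʳ-onto : ∀ {R} → Binary R → ∃ λ k → binʳ (suc k) ≡ R ++ [ d1 ]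
binʳ-onto [] = zero , refl
binʳ-onto (b ∷0) with binʳ-onto b
... | k , e = k + suc k , trans (binʳ-even k) (cong (d0 ∷_) e)
binʳ-onto (b ∷1) with binʳ-onto b
... | k , e = suc k + suc k , trans (binʳ-odd (suc k)) (cong (d1 ∷_) e)

bin-onto : ∀ {Z} → Binary Z → ∃ λ k → bin k ≡ d1 ∷ Z
bin-onto {Z} b with binʳ-onto (binary-reverse b)
... | k , e = suc k , (begin
    reverse (binʳ (suc k))         ≡⟨ cong reverse e ⟩
    reverse (reverse Z ++ [ d1 ])  ≡⟨ reverse-++ (reverse Z) [ d1 ] ⟩
    d1 ∷ reverse (reverse Z)       ≡⟨ cong (d1 ∷_) (reverse-involutive Z) ⟩
    d1 ∷ Z                         ∎)
  where open ≡-Reasoning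

data Pad : Str → Set where
  no-pad   : Pad []
  zero-pad : Pad [ d0 ]

pad-binary : ∀ {z} → Pad z → Binary z
pad-binary no-pad = []
pad-binary zero-pad = [] ∷0

pad-reverse : ∀ {z} → Pad z → reverse z ≡ z
pad-reverse no-pad = refl
pad-reverse zero-pad = refl

-- LSB-first form: Tʳ stops at the first 0; if there is none, a padding 0
-- is consumed instead of the implicit leading 0.
Tʳ-pad : ∀ r → ∃ λ z → Pad z × (∀ s → Tʳ (r ++ z ++ s) ≡ Tʳ r ++ s)
Tʳ-pad []                    = [ d0 ] , zero-pad , λ s → refl
Tʳ-pad (zero ∷ ds)           = [] , no-pad , λ s → refl
Tʳ-pad (suc zero ∷ ds)       with Tʳ-pad ds
... | z , p , f = z , p , λ s → cong (d0 ∷_) (f s)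
Tʳ-pad (suc (suc zero) ∷ ds) with Tʳ-pad ds
... | z , p , f = z , p , λ s → cong (d1 ∷_) (f s)

T-pad : ∀ u → ∃ λ z → Pad z × (∀ Y → T (Y ++ z ++ u) ≡ Y ++ T u)
T-pad u with Tʳ-pad (reverse u)
... | z , p , f = z , p , λ Y → begin
    reverse (Tʳ (reverse (Y ++ z ++ u)))
      ≡⟨ cong T′ (reverse-++ Y (z ++ u)) ⟩
    reverse (Tʳ (reverse (z ++ u) ++ reverse Y))
      ≡⟨ cong (λ w → reverse (Tʳ (w ++ reverse Y))) (reverse-++ z u) ⟩
    reverse (Tʳ ((reverse u ++ reverse z) ++ reverse Y))
      ≡⟨ cong T′ (++-assoc (reverse u) (reverse z) (reverse Y)) ⟩
    reverse (Tʳ (reverse u ++ reverse z ++ reverse Y))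
      ≡⟨ cong (λ w → reverse (Tʳ (reverse u ++ w ++ reverse Y))) (pad-reverse p) ⟩
    reverse (Tʳ (reverse u ++ z ++ reverse Y))
      ≡⟨ cong reverse (f (reverse Y)) ⟩
    reverse (Tʳ (reverse u) ++ reverse Y)
      ≡⟨ reverse-++ (Tʳ (reverse u)) (reverse Y) ⟩
    reverse (reverse Y) ++ T u
      ≡⟨ cong (_++ T u) (reverse-involutive Y) ⟩
    Y ++ T u ∎
  where
  open ≡-Reasoning
  T′ : Str → Str
  T′ w = reverse (Tʳ w)

-- Strengthened form for induction on the row: any prefix 1Y, Y binary.
row-closed : ∀ i j {Y} → Binary Y → ∃ λ j′ → d1 ∷ Y ++ G i j ≡ G i j′
row-closed zero j b with bin-onto (binary-++ b (binary-bin j))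
... | k , e = k , sym e
row-closed (suc i) j {Y} b with T-pad (G i j)
... | z , p , commute with row-closed i j (binary-++ b (pad-binary p))
... | j′ , e = j′ , (begin
    d1 ∷ Y ++ T (G i j)        ≡⟨ sym (commute (d1 ∷ Y)) ⟩
    T (d1 ∷ Y ++ z ++ G i j)   ≡⟨ cong (λ w → T (d1 ∷ w)) (sym (++-assoc Y z (G i j))) ⟩
    T (d1 ∷ (Y ++ z) ++ G i j) ≡⟨ cong T e ⟩
    T (G i j′)                 ∎)
  where open ≡-Reasoning

lemma2 : (i j : ℕ) (Y : Str) → Binary Y → EmptyOrStarts1 Y →
    ∃ λ j′ → Y ++ G i j ≡ G i j′
lemma2 i j .[] b empty = j , refl
lemma2 i j (_ ∷ Y) (b ∷1) starts = row-closed i j b
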